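{- Let $\Gamma\subseteq\mathcal{L}$ be strongly compositional, and let $\pi,\pi'$ be maximal $\models^*$-models of $\Gamma$. Then (i) for every $\varphi\in\Gamma$, $\pi\models\varphi$ if and only if $\pi'\models\varphi$; and (ii) if $\Gamma$ is consistent, then the set of maximal models of $\Gamma$ equals the set of maximal $\models^*$-models of $\Gamma$.
   Context: Let $V$ be a finite set of variables with finite nonempty domains. A lex model $\pi$ is a (possibly empty) sequence $(Y_1,\ge_{Y_1}),\ldots,(Y_k,\ge_{Y_k})$ of pairwise distinct variables each with a total order on its domain; $V_\pi=\{Y_1,\ldots,Y_k\}$; $\mathcal{G}$ is the set of lex models. For $\pi'=(Z_1,\ge_{Z_1}),\ldots$, $\pi\circ\pi'$ is $\pi$ followed by $\pi'$ with pairs whose variable is in $V_\pi$ deleted. $\pi'$ extends $\pi$ if $\pi'\ne\pi$ and $\pi'$ begins with $\pi$; $\pi'\sqsupseteq\pi$ means extends or equals. $\mathcal{L}$ is an arbitrary set of statements with satisfaction relation $\models\ \subseteq\mathcal{G}\times\mathcal{L}$; $\pi\models\Gamma$ iff $\pi\models\varphi$ for all $\varphi\in\Gamma$; $\Gamma$ is consistent if it has a model; a maximal model of $\Gamma$ is a model of $\Gamma$ no extension of which satisfies $\Gamma$. $\pi\models^*\varphi$ iff some $\pi'\sqsupseteq\pi$ has $\pi'\models\varphi$; $\pi\models^*\Gamma$ iff $\pi\models^*\varphi$ for all $\varphi\in\Gamma$; a maximal $\models^*$-model of $\Gamma$ is a $\pi$ with $\pi\models^*\Gamma$ such that no lex model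 extending $\pi$ $\models^*$-satisfies $\Gamma$. $\varphi$ is strongly compositional if for all $\pi,\pi'$, $\pi\models^*\varphi$ and $\pi'\models\varphi$ imply $\pi\circ\pi'\models\varphi$; $\Gamma$ is strongly compositional if all its elements are. -}

module Defs where

open import Data.Nat using (ℕ; NonZero)
open import Data.Fin using (Fin)
import Data.Fin.Properties as FinP
open import Data.List using (List; []; _++_; map; filter)
open import Data.List.Relation.Unary.All using (All)
open import Data.List.Relation.Unary.Unique.Propositional using (Unique)
open import Data.List.Membership.Propositional using (_∈_)
import Data.List.Membership.DecPropositional as DecMem
open import Data.Product using (Σ; ∃; _×_; _,_; proj₁; proj₂)
open import Relation.Nullary using (¬_; ¬?)
open import Relation.Binary.PropositionalEquality using (_≡_; _≢_)
open import Relation.Unary using (Pred)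
open import Function.Bundles using (_⇔_)

-- Variables are Fin n; variable i has finite domain Fin (d i).
-- A total order on the finite domain Fin k is represented by the listing of
-- its elements from best to worst (a duplicate-free list containing every
-- element); x ≥ y iff x occurs no later than y.
IsTotalOrderListing : {k : ℕ} → List (Fin k) → Set
IsTotalOrderListing {k} xs = Unique xs × (∀ (x : Fin k) → x ∈ xs)

Entry : (n : ℕ) → (Fin n → ℕ) → Set
Entry n d = Σ (Fin n) (λ i → List (Fin (d i)))

-- A raw sequence of pairs; lex models are the well-formed ones.
Seq : (n : ℕ) → (Fin n → ℕ) → Set
Seq n d = List (Entry n d)

vars : {n : ℕ} {d : Fin n → ℕ} → Seq n d → List (Fin n)
vars π = map proj₁ π

IsLex : {n : ℕ} {d : Fin n → ℕ} → Seq n d → Set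
IsLex {n} {d} π = Unique (vars π) × All (λ (e : Entry n d) → IsTotalOrderListing (proj₂ e)) π

_∘ₗ_ : {n : ℕ} {d : Fin n → ℕ} → Seq n d → Seq n d → Seq n d
_∘ₗ_ {n} π π' = π ++ filter (λ e → ¬? (proj₁ e ∈? vars π)) π'
  where open DecMem (FinP._≟_ {n}) using (_∈?_)

_⊒_ : {n : ℕ} {d : Fin n → ℕ} → Seq n d → Seq n d → Set
π' ⊒ π = ∃ λ rest → π' ≡ π ++ rest

Extends : {n : ℕ} {d : Fin n → ℕ} → Seq n d → Seq n d → Set
Extends π' π = (π' ≢ π) × (π' ⊒ π)

module Semantics {n : ℕ} {d : Fin n → ℕ} (L : Set) (_⊨_ : Seq n d → L → Set) where

  _⊨Γ_ : Seq n d → Pred L _ → Set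
  π ⊨Γ Γ = ∀ φ → Γ φ → π ⊨ φ

  Consistent : Pred L _ → Set
  Consistent Γ = ∃ λ π → IsLex π × (π ⊨Γ Γ)

  MaximalModel : Pred L _ → Seq n d → Set
  MaximalModel Γ π = IsLex π × (π ⊨Γ Γ) ×
    (∀ π' → IsLex π' → Extends π' π → ¬ (π' ⊨Γ Γ))

  _⊨*_ : Seq n d → L → Set
  π ⊨* φ = ∃ λ π' → IsLex π' × (π' ⊒ π) × (π' ⊨ φ)

  _⊨*Γ_ : Seq n d → Pred L _ → Set
  π ⊨*Γ Γ = ∀ φ → Γ φ → π ⊨* φ

  MaximalStarModel : Pred L _ → Seq n d → Set
  MaximalStarModel Γ π = IsLex π × (π ⊨*Γ Γ) ×
    (∀ π' → IsLex π' → Extends π' π → ¬ (π' ⊨*Γ Γ))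

  StronglyCompositional : L → Set
  StronglyCompositional φ = ∀ π π' → IsLex π → IsLex π' →
    π ⊨* φ → π' ⊨ φ → (π ∘ₗ π') ⊨ φ

  StronglyCompositionalSet : Pred L _ → Set
  StronglyCompositionalSet Γ = ∀ φ → Γ φ → StronglyCompositional φ

{-# OPTIONS --safe #-}
-- A maximal ⊨*-model π absorbs every ⊨*-model τ: by strong compositionality
-- π ∘ τ ⊨*-satisfies Γ, and π ∘ τ begins with π, so maximality forces π ∘ τ = π.
-- For (i), strong compositionality applied to π' (a ⊨*-model) and π gives
-- π' ∘ π ⊨ φ whenever π ⊨ φ, and π' ∘ π = π'. For (ii), absorbing a model σ of Γ
-- shows that a maximal ⊨*-model is a model; conversely, if a maximal model ρ had a
-- proper extension π ⊨*-satisfying Γ, then π = π ∘ ρ would satisfy Γ.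
module Submission where

open import Defs
open import Data.Nat using (ℕ; NonZero)
open import Data.Fin using (Fin)
import Data.Fin.Properties as FinP
open import Data.Product using (_×_; _,_; proj₁)
open import Data.Sum using (_⊎_; inj₁; inj₂)
open import Data.List using ([]; _∷_; _++_; filter)
open import Data.List.Properties using (map-++; ++-identityʳ; ++-identityʳ-unique; ++-assoc; filter-++; filter-none)
import Data.List.Relation.Unary.All as All
import Data.List.Relation.Unary.All.Properties as AllP
import Data.List.Relation.Unary.AllPairs.Properties as AllPairsP
open import Data.List.Relation.Unary.Unique.Propositional using (Unique)
import Data.List.Relation.Unary.Unique.Propositional.Properties as UniqueP
open import Data.List.Membership.Propositional using (_∈_)
open import Data.List.Membership.Propositional.Properties using (∈-map⁺; ∈-++⁺ˡ)
import Data.List.Membership.DecPropositional as DecMem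
open import Relation.Nullary using (¬_; ¬?)
open import Relation.Unary using (Pred; Decidable)
open import Relation.Binary.PropositionalEquality using (_≡_; refl; sym; trans; cong; subst; module ≡-Reasoning)
open import Level using (0ℓ)
open import Function.Bundles using (_⇔_; mk⇔)
open import Function using (_∘′_)
open import Data.Empty using (⊥-elim)

module _ {n : ℕ} {d : Fin n → ℕ} where
  open DecMem (FinP._≟_ {n}) using (_∈?_)

  Fresh : Seq n d → Entry n d → Set
  Fresh π e = ¬ (proj₁ e ∈ vars π)

  fresh? : (π : Seq n d) → Decidable (Fresh π)
  fresh? π e = ¬? (proj₁ e ∈? vars π)

  unique-vars-filter : {P : Pred (Entry n d) 0ℓ} (P? : Decidable P) (xs : Seq n d) →
    Unique (vars xs) → Unique (vars (filter P? xs))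
  unique-vars-filter P? xs =
    AllPairsP.map⁺ ∘′ AllPairsP.filter⁺ P? ∘′ AllPairsP.map⁻

  ∘ₗ-isLex : {π τ : Seq n d} → IsLex π → IsLex τ → IsLex (π ∘ₗ τ)
  ∘ₗ-isLex {π} {τ} (uπ , ordersπ) (uτ , ordersτ) =
    subst Unique (sym (map-++ proj₁ π (filter (fresh? π) τ)))
      (UniqueP.++⁺ uπ (unique-vars-filter (fresh? π) τ uτ) disjoint)
    , AllP.++⁺ ordersπ (AllP.filter⁺ (fresh? π) ordersτ)
    where
    disjoint : ∀ {v} → ¬ (v ∈ vars π × v ∈ vars (filter (fresh? π) τ))
    disjoint (v∈π , v∈τ) =
      All.lookup (AllP.map⁺ (AllP.all-filter (fresh? π) τ)) v∈τ v∈π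

  ∘ₗ-⊒ : (π τ : Seq n d) → (π ∘ₗ τ) ⊒ π
  ∘ₗ-⊒ π τ = filter (fresh? π) τ , refl

  ∘ₗ-monoʳ-⊒ : (π : Seq n d) {τ τ' : Seq n d} → τ' ⊒ τ → (π ∘ₗ τ') ⊒ (π ∘ₗ τ)
  ∘ₗ-monoʳ-⊒ π {τ} (rest , refl) = filter (fresh? π) rest , (begin
    π ++ filter (fresh? π) (τ ++ rest)
      ≡⟨ cong (π ++_) (filter-++ (fresh? π) τ rest) ⟩
    π ++ (filter (fresh? π) τ ++ filter (fresh? π) rest)
      ≡⟨ sym (++-assoc π _ _) ⟩
    (π ∘ₗ τ) ++ filter (fresh? π) rest ∎)
    where open ≡-Reasoning

  ∘ₗ-absorbs-prefix : {π ρ : Seq n d} → π ⊒ ρ → π ∘ₗ ρ ≡ π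
  ∘ₗ-absorbs-prefix {π} {ρ} (rest , π≡ρ++rest) =
    trans (cong (π ++_) (filter-none (fresh? π) (All.tabulate ρ-vars∈π))) (++-identityʳ π)
    where
    ρ-vars∈π : ∀ {e} → e ∈ ρ → ¬ Fresh π e
    ρ-vars∈π {e} e∈ρ fresh = fresh (subst (λ σ → proj₁ e ∈ vars σ) (sym π≡ρ++rest)
      (subst (proj₁ e ∈_) (sym (map-++ proj₁ ρ rest)) (∈-++⁺ˡ (∈-map⁺ proj₁ e∈ρ))))

  ⊒⇒≡⊎Extends : {π' π : Seq n d} → π' ⊒ π → π' ≡ π ⊎ Extends π' π
  ⊒⇒≡⊎Extends {π = π} ([] , refl) = inj₁ (++-identityʳ π)
  ⊒⇒≡⊎Extends {π = π} (e ∷ rest , refl) = inj₂ (proper , (e ∷ rest , refl))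
    where
    proper : ¬ (π ++ e ∷ rest ≡ π)
    proper eq with ++-identityʳ-unique π (sym eq)
    ... | ()

module _ {n : ℕ} {d : Fin n → ℕ} (L : Set) (_⊨_ : Seq n d → L → Set) where
  open Semantics L _⊨_

  ⊨Γ⇒⊨*Γ : {Γ : Pred L 0ℓ} {σ : Seq n d} → IsLex σ → σ ⊨Γ Γ → σ ⊨*Γ Γ
  ⊨Γ⇒⊨*Γ {σ = σ} lexσ σ⊨Γ φ φ∈Γ = σ , lexσ , ([] , sym (++-identityʳ σ)) , σ⊨Γ φ φ∈Γ

  module _ {Γ : Pred L 0ℓ} (compositional : StronglyCompositionalSet Γ) where

    ∘ₗ-⊨Γ : {π τ : Seq n d} → IsLex π → IsLex τ → π ⊨*Γ Γ → τ ⊨Γ Γ → (π ∘ₗ τ) ⊨Γ Γ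
    ∘ₗ-⊨Γ {π} {τ} lexπ lexτ π⊨*Γ τ⊨Γ φ φ∈Γ =
      compositional φ φ∈Γ π τ lexπ lexτ (π⊨*Γ φ φ∈Γ) (τ⊨Γ φ φ∈Γ)

    ∘ₗ-⊨*Γ : {π τ : Seq n d} → IsLex π → π ⊨*Γ Γ → τ ⊨*Γ Γ → (π ∘ₗ τ) ⊨*Γ Γ
    ∘ₗ-⊨*Γ {π} lexπ π⊨*Γ τ⊨*Γ φ φ∈Γ with τ⊨*Γ φ φ∈Γ
    ... | τ' , lexτ' , τ'⊒τ , τ'⊨φ =
      π ∘ₗ τ' , ∘ₗ-isLex lexπ lexτ' , ∘ₗ-monoʳ-⊒ π τ'⊒τ ,
      compositional φ φ∈Γ π τ' lexπ lexτ' (π⊨*Γ φ φ∈Γ) τ'⊨φ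

    MaximalStarModel-absorbs : {π τ : Seq n d} → MaximalStarModel Γ π →
      IsLex τ → τ ⊨*Γ Γ → π ∘ₗ τ ≡ π
    MaximalStarModel-absorbs {π} {τ} (lexπ , π⊨*Γ , maximal) lexτ τ⊨*Γ
      with ⊒⇒≡⊎Extends (∘ₗ-⊒ π τ)
    ... | inj₁ π∘τ≡π = π∘τ≡π
    ... | inj₂ extends =
      ⊥-elim (maximal (π ∘ₗ τ) (∘ₗ-isLex lexπ lexτ) extends (∘ₗ-⊨*Γ lexπ π⊨*Γ τ⊨*Γ))

    MaximalStarModel-⊨-transfer : {π π' : Seq n d} →
      MaximalStarModel Γ π → MaximalStarModel Γ π' →
      ∀ φ → Γ φ → π ⊨ φ → π' ⊨ φ
    MaximalStarModel-⊨-transfer {π} {π'} (lexπ , π⊨*Γ , _) max'@(lexπ' , π'⊨*Γ , _) φ φ∈Γ π⊨φ =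
      subst (_⊨ φ) (MaximalStarModel-absorbs max' lexπ π⊨*Γ)
        (compositional φ φ∈Γ π' π lexπ' lexπ (π'⊨*Γ φ φ∈Γ) π⊨φ)

    MaximalStarModel⇒MaximalModel : Consistent Γ → {ρ : Seq n d} →
      MaximalStarModel Γ ρ → MaximalModel Γ ρ
    MaximalStarModel⇒MaximalModel (σ , lexσ , σ⊨Γ) {ρ} maxρ@(lexρ , ρ⊨*Γ , maximal) =
      lexρ , ρ⊨Γ , λ π lexπ extends π⊨Γ → maximal π lexπ extends (⊨Γ⇒⊨*Γ lexπ π⊨Γ)
      where
      ρ∘σ⊨Γ : (ρ ∘ₗ σ) ⊨Γ Γ
      ρ∘σ⊨Γ = ∘ₗ-⊨Γ lexρ lexσ ρ⊨*Γ σ⊨Γ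
      ρ⊨Γ : ρ ⊨Γ Γ
      ρ⊨Γ φ φ∈Γ = subst (_⊨ φ)
        (MaximalStarModel-absorbs maxρ lexσ (⊨Γ⇒⊨*Γ lexσ σ⊨Γ))
        (ρ∘σ⊨Γ φ φ∈Γ)

    MaximalModel⇒MaximalStarModel : {ρ : Seq n d} → MaximalModel Γ ρ → MaximalStarModel Γ ρ
    MaximalModel⇒MaximalStarModel (lexρ , ρ⊨Γ , maximal) =
      lexρ , ⊨Γ⇒⊨*Γ lexρ ρ⊨Γ , λ π lexπ extends@(_ , π⊒ρ) π⊨*Γ →
        maximal π lexπ extends λ φ φ∈Γ →
          subst (_⊨ φ) (∘ₗ-absorbs-prefix π⊒ρ) (∘ₗ-⊨Γ lexπ lexρ π⊨*Γ ρ⊨Γ φ φ∈Γ)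

proposition3 : (n : ℕ) (d : Fin n → ℕ) → (∀ i → NonZero (d i)) →
    (L : Set) (_⊨_ : Seq n d → L → Set) (Γ : Pred L 0ℓ) →
    let open Semantics L _⊨_ in
    StronglyCompositionalSet Γ →
    (π π' : Seq n d) → MaximalStarModel Γ π → MaximalStarModel Γ π' →
    (∀ φ → Γ φ → (π ⊨ φ ⇔ π' ⊨ φ)) ×
    (Consistent Γ → ∀ ρ → (MaximalModel Γ ρ ⇔ MaximalStarModel Γ ρ))
proposition3 n d _ L _⊨_ Γ compositional π π' maxπ maxπ' =
  (λ φ φ∈Γ → mk⇔ (transfer maxπ maxπ' φ φ∈Γ) (transfer maxπ' maxπ φ φ∈Γ)) ,
  (λ consistent ρ → mk⇔ (MaximalModel⇒MaximalStarModel L _⊨_ compositional)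
                        (MaximalStarModel⇒MaximalModel L _⊨_ compositional consistent))
  where transfer = MaximalStarModel-⊨-transfer L _⊨_ compositional
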